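{- The family of complete bipartite graphs $\overline{K}_m \vee \overline{K}_n$ with $m \leq n$ has sensitivity \[ \sigma(\overline{K}_m \vee \overline{K}_n) = \begin{cases} n+1-m & \text{ if $m \leq \left\lfloor \frac{n+1}{2}\right\rfloor$,} \\ \left\lceil \frac{n+1}{2} \right\rceil & \text{ if $m > \left\lfloor \frac{n+1}{2}\right\rfloor$.} \end{cases} \] Thus the family $\{\overline{K}_m \vee \overline{K}_n\}_{n=1}^\infty$ is sensitive and provided $\left\lfloor \frac{n+1}{2}\right\rfloor <m \leq n$ stays true the family $\{\overline{K}_m \vee \overline{K}_n\}_{m,n=1}^\infty$ is also sensitive. In particular, the complete regular bipartite graph $\overline{K}_n \vee \overline{K}_n$ has sensitivity $\sigma(\overline{K}_n \vee \overline{K}_n) = \left\lceil \frac{n+1}{2} \right\rceil$, and the family $\{\overline{K}_n \vee \overline{K}_n\}_{n=1}^\infty$ is sensitive.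
   Context: All graphs are finite, undirected and simple. $\overline{K}_n$ denotes the empty (edgeless) graph on $n$ vertices and $\vee$ the join (disjoint union plus all edges between the two graphs), so $\overline{K}_m\vee\overline{K}_n=K_{m,n}$. $\alpha(G)$ is the independence number and $\Delta(G)$ the maximum degree. The sensitivity of a nonempty graph $G=(V,E)$ is $\sigma(G)=\min\{\Delta(G[S]) : S\subseteq V,\ |S|>\alpha(G)\}$. An indexed family of graphs $G_n$ with $\Delta(G_n)\to\infty$ is called sensitive if $\sigma(G_n)\to\infty$ and insensitive otherwise. -}

module Defs where

open import Data.Nat using (ℕ; zero; suc; _+_; _∸_; _≤_; _<_; _<ᵇ_; _⊔_)
open import Data.Bool using (Bool; true; false; _xor_; if_then_else_)
open import Data.Fin using (Fin; toℕ)
open import Data.Fin.Subset using (Subset; _∈_; _∩_; ∣_∣; ⊤)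
open import Data.Vec using (Vec; tabulate; lookup; allFin; foldr′; map)
open import Data.Product using (Σ; ∃; ∃-syntax; _×_; _,_)
open import Relation.Binary.PropositionalEquality using (_≡_; refl)

record Graph (k : ℕ) : Set where
  field
    adj    : Fin k → Fin k → Bool
    sym    : ∀ i j → adj i j ≡ adj j i
    irrefl : ∀ i → adj i i ≡ false
open Graph public

Independent : ∀ {k} → Graph k → Subset k → Set
Independent G S = ∀ i j → i ∈ S → j ∈ S → adj G i j ≡ false

IsIndependenceNumber : ∀ {k} → Graph k → ℕ → Set
IsIndependenceNumber G a =
  (∃[ S ] (Independent G S × ∣ S ∣ ≡ a)) × (∀ S → Independent G S → ∣ S ∣ ≤ a)

nbhd : ∀ {k} → Graph k → Fin k → Subset k
nbhd G v = tabulate (adj G v)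

degIn : ∀ {k} → Graph k → Subset k → Fin k → ℕ
degIn G S v = ∣ S ∩ nbhd G v ∣

-- Maximum degree Δ(G[S]) of the induced subgraph G[S] (0 if S is empty).
maxDegIn : ∀ {k} → Graph k → Subset k → ℕ
maxDegIn {k} G S =
  foldr′ _⊔_ 0 (map (λ v → if lookup S v then degIn G S v else 0) (allFin k))

maxDeg : ∀ {k} → Graph k → ℕ
maxDeg G = maxDegIn G ⊤

IsSensitivity : ∀ {k} → Graph k → ℕ → Set
IsSensitivity G s =
  Σ ℕ λ a → IsIndependenceNumber G a ×
    ((∃[ S ] (a < ∣ S ∣ × maxDegIn G S ≡ s)) ×
     (∀ S → a < ∣ S ∣ → s ≤ maxDegIn G S))

-- The complete bipartite graph K̄_m ∨ K̄_n = K_{m,n} on Fin (m + n):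
-- vertices with index < m form one side, the others the other side.
side : ∀ {m n} → Fin (m + n) → Bool
side {m} i = toℕ i <ᵇ m

xor-comm : ∀ a b → (a xor b) ≡ (b xor a)
xor-comm false false = refl
xor-comm false true  = refl
xor-comm true  false = refl
xor-comm true  true  = refl

xor-self : ∀ a → (a xor a) ≡ false
xor-self false = refl
xor-self true  = refl

completeBipartite : (m n : ℕ) → Graph (m + n)
completeBipartite m n = record
  { adj    = λ i j → side {m} {n} i xor side {m} {n} j
  ; sym    = λ i j → xor-comm (side {m} {n} i) (side {m} {n} j)
  ; irrefl = λ i → xor-self (side {m} {n} i)
  }

-- A family of graphs (G i)_{i : I}, indexed along ρ : I → ℕ (the family
-- "tends to infinity" as ρ i → ∞), is sensitive if Δ(G i) → ∞ and σ(G i) → ∞.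
Sensitive : {I : Set} (ρ : I → ℕ) (k : I → ℕ) (G : (i : I) → Graph (k i)) → Set
Sensitive ρ k G =
  (∀ B → ∃[ N ] ∀ i → N ≤ ρ i → B ≤ maxDeg (G i)) ×
  (∀ B → ∃[ N ] ∀ i → N ≤ ρ i → ∀ s → IsSensitivity (G i) s → B ≤ s)

-- Write a vertex set of K̄_m ∨ K̄_n as L ++ R, L on the side of size m. In the induced
-- subgraph every vertex of L has degree ∣ R ∣ and every vertex of R has degree ∣ L ∣,
-- and the set is independent iff L or R is empty; hence α = n when m ≤ n. A set with
-- more than n vertices meets both sides, so its maximum degree is ∣ L ∣ ⊔ ∣ R ∣, and σ
-- is the least ℓ ⊔ r over ℓ ≤ m, r ≤ n, n < ℓ + r (IsMinMax). This is attained at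
-- ℓ = m when m ≤ ⌊(n+1)/2⌋ and at the balanced split otherwise; in every case
-- ℓ ⊔ r ≥ ⌈(n+1)/2⌉, which forces σ → ∞ along each family, while Δ = n.

module Submission where

open import Defs
open import Data.Nat using (ℕ; suc; _+_; _∸_; _≤_; _<_; ⌊_/2⌋; ⌈_/2⌉)
open import Data.Product using (Σ; _×_; proj₁; proj₂)

open import Data.Nat using (zero; _⊔_; z≤n; s≤s; s≤s⁻¹; z<s)
open import Data.Nat.Properties
open import Data.Bool using (Bool; true; false; not; _∧_; _xor_; if_then_else_)
open import Data.Bool.Properties using (not-injective)
open import Data.Fin using (Fin; _↑ˡ_; _↑ʳ_) renaming (zero to fzero; suc to fsuc)
open import Data.Fin.Subset using (Subset; inside; outside; _∈_; _∩_; ∣_∣; ⊤; ⊥; Empty)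
open import Data.Fin.Subset.Properties using (∣⊥∣≡0; ∣⊤∣≡n; ∣p∣≤n; ∩-zeroʳ; ∩-identityʳ; nonempty?; Empty-unique)
open import Data.Vec using (Vec; []; _∷_; _++_; tabulate; lookup; map; allFin; foldr′; splitAt; here; there)
open import Data.Vec.Properties
  using (tabulate-∘; tabulate-cong; tabulate-allFin; tabulate∘lookup; map-++; map-replicate; map-const;
         zipWith-++; lookup-++ˡ; lookup-++ʳ; lookup∘tabulate; []=⇒lookup)
open import Data.Product using (_,_; ∃₂; ∃-syntax)
open import Data.Sum using (_⊎_; inj₁; inj₂)
open import Function using (_∘_)
open import Relation.Nullary using (yes; no; contradiction)
open import Relation.Binary.PropositionalEquality using (_≡_; refl; trans; cong; cong₂; subst; module ≡-Reasoning)
  renaming (sym to ≡-sym)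

∣p++q∣≡∣p∣+∣q∣ : ∀ {m n} (p : Subset m) (q : Subset n) → ∣ p ++ q ∣ ≡ ∣ p ∣ + ∣ q ∣
∣p++q∣≡∣p∣+∣q∣ []            q = refl
∣p++q∣≡∣p∣+∣q∣ (inside  ∷ p) q = cong suc (∣p++q∣≡∣p∣+∣q∣ p q)
∣p++q∣≡∣p∣+∣q∣ (outside ∷ p) q = ∣p++q∣≡∣p∣+∣q∣ p q

∈-++⁺ˡ : ∀ {m n} {i : Fin m} {p : Subset m} (q : Subset n) → i ∈ p → i ↑ˡ n ∈ p ++ q
∈-++⁺ˡ q here        = here
∈-++⁺ˡ q (there i∈p) = there (∈-++⁺ˡ q i∈p)

∈-++⁺ʳ : ∀ {m n} {j : Fin n} (p : Subset m) {q : Subset n} → j ∈ q → m ↑ʳ j ∈ p ++ q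
∈-++⁺ʳ []      j∈q = j∈q
∈-++⁺ʳ (_ ∷ p) j∈q = there (∈-++⁺ʳ p j∈q)

⊤-++ : ∀ m n → ⊤ {m + n} ≡ ⊤ {m} ++ ⊤ {n}
⊤-++ zero    n = refl
⊤-++ (suc m) n = cong (inside ∷_) (⊤-++ m n)

∣Empty∣≡0 : ∀ {k} {p : Subset k} → Empty p → ∣ p ∣ ≡ 0
∣Empty∣≡0 {k} p-empty = trans (cong ∣_∣ (Empty-unique p-empty)) (∣⊥∣≡0 k)

subsetOfSize : ∀ {ℓ m} → ℓ ≤ m → Σ (Subset m) λ p → ∣ p ∣ ≡ ℓ
subsetOfSize {m = m} z≤n = ⊥ , ∣⊥∣≡0 m
subsetOfSize (s≤s ℓ≤m) with subsetOfSize ℓ≤m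
... | p , ∣p∣≡ℓ = inside ∷ p , cong suc ∣p∣≡ℓ

tabulate-++ : ∀ {A : Set} m {n} (f : Fin (m + n) → A) →
  tabulate f ≡ tabulate (λ i → f (i ↑ˡ n)) ++ tabulate (λ j → f (m ↑ʳ j))
tabulate-++ zero    f = refl
tabulate-++ (suc m) f = cong (f fzero ∷_) (tabulate-++ m (f ∘ fsuc))

⊔-foldr-++ : ∀ {m n} (xs : Vec ℕ m) (ys : Vec ℕ n) →
  foldr′ _⊔_ 0 (xs ++ ys) ≡ foldr′ _⊔_ 0 xs ⊔ foldr′ _⊔_ 0 ys
⊔-foldr-++ []       ys = refl
⊔-foldr-++ (x ∷ xs) ys = trans (cong (x ⊔_) (⊔-foldr-++ xs ys)) (≡-sym (⊔-assoc x _ _))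

ifMember : ℕ → Bool → ℕ
ifMember x b = if b then x else 0

⊔-foldr-ifMember-≤ : ∀ {k} x (p : Subset k) → foldr′ _⊔_ 0 (map (ifMember x) p) ≤ x
⊔-foldr-ifMember-≤ x []            = z≤n
⊔-foldr-ifMember-≤ x (inside  ∷ p) = ⊔-lub ≤-refl (⊔-foldr-ifMember-≤ x p)
⊔-foldr-ifMember-≤ x (outside ∷ p) = ⊔-foldr-ifMember-≤ x p

⊔-foldr-ifMember : ∀ {k} x (p : Subset k) → 0 < ∣ p ∣ → foldr′ _⊔_ 0 (map (ifMember x) p) ≡ x
⊔-foldr-ifMember x (inside  ∷ p) _     = m≥n⇒m⊔n≡m (⊔-foldr-ifMember-≤ x p)
⊔-foldr-ifMember x (outside ∷ p) 0<∣p∣ = ⊔-foldr-ifMember x p 0<∣p∣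

Admissible : (m n ℓ r : ℕ) → Set
Admissible m n ℓ r = ℓ ≤ m × r ≤ n × n < ℓ + r

IsMinMax : (m n s : ℕ) → Set
IsMinMax m n s =
  (∃₂ λ ℓ r → Admissible m n ℓ r × ℓ ⊔ r ≡ s) × (∀ ℓ r → Admissible m n ℓ r → s ≤ ℓ ⊔ r)

n<ℓ+r⇒r≤n⇒0<ℓ : ∀ {n ℓ r} → n < ℓ + r → r ≤ n → 0 < ℓ
n<ℓ+r⇒r≤n⇒0<ℓ {ℓ = zero}  n<r r≤n = contradiction r≤n (<⇒≱ n<r)
n<ℓ+r⇒r≤n⇒0<ℓ {ℓ = suc _} _   _   = z<s

admissible-positive : ∀ {m n ℓ r} → m ≤ n → Admissible m n ℓ r → 0 < ℓ × 0 < r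
admissible-positive {n = n} {ℓ} {r} m≤n (ℓ≤m , r≤n , n<ℓ+r) =
  n<ℓ+r⇒r≤n⇒0<ℓ n<ℓ+r r≤n ,
  n<ℓ+r⇒r≤n⇒0<ℓ (subst (n <_) (+-comm ℓ r) n<ℓ+r) (≤-trans ℓ≤m m≤n)

n<ℓ+r⇒⌈1+n/2⌉≤ℓ⊔r : ∀ {n} ℓ r → n < ℓ + r → ⌈ suc n /2⌉ ≤ ℓ ⊔ r
n<ℓ+r⇒⌈1+n/2⌉≤ℓ⊔r {n} ℓ r n<ℓ+r = begin
  ⌈ suc n /2⌉                 ≤⟨ ⌈n/2⌉-mono (≤-trans n<ℓ+r (+-mono-≤ (m≤m⊔n ℓ r) (m≤n⊔m ℓ r))) ⟩
  ⌈ (ℓ ⊔ r) + (ℓ ⊔ r) /2⌉     ≡⟨ n≡⌈n+n/2⌉ (ℓ ⊔ r) ⟨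
  ℓ ⊔ r                       ∎
  where open ≤-Reasoning

B+B≤n⇒B≤⌈1+n/2⌉ : ∀ {B n} → B + B ≤ n → B ≤ ⌈ suc n /2⌉
B+B≤n⇒B≤⌈1+n/2⌉ {B} B+B≤n = begin
  B                 ≡⟨ n≡⌈n+n/2⌉ B ⟩
  ⌈ B + B /2⌉       ≤⟨ ⌈n/2⌉-mono (m≤n⇒m≤1+n B+B≤n) ⟩
  ⌈ suc _ /2⌉       ∎
  where open ≤-Reasoning

isMinMax-unbalanced : ∀ {m n} → 0 < m → m ≤ ⌊ suc n /2⌋ → IsMinMax m n (suc n ∸ m)
isMinMax-unbalanced {m} {n} 0<m m≤half = (m , suc n ∸ m , admissible , m≤n⇒m⊔n≡n m≤1+n∸m) , least
  where
  m+m≤1+n : m + m ≤ suc n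
  m+m≤1+n = begin
    m + m                           ≤⟨ +-mono-≤ m≤half (≤-trans m≤half (⌊n/2⌋≤⌈n/2⌉ (suc n))) ⟩
    ⌊ suc n /2⌋ + ⌈ suc n /2⌉       ≡⟨ ⌊n/2⌋+⌈n/2⌉≡n (suc n) ⟩
    suc n                           ∎
    where open ≤-Reasoning

  m≤1+n∸m : m ≤ suc n ∸ m
  m≤1+n∸m = m+n≤o⇒m≤o∸n m m+m≤1+n

  admissible : Admissible m n m (suc n ∸ m)
  admissible = ≤-refl , ∸-monoʳ-≤ (suc n) 0<m , ≤-reflexive (≡-sym (m+[n∸m]≡n (m+n≤o⇒n≤o m m+m≤1+n)))

  least : ∀ ℓ r → Admissible m n ℓ r → suc n ∸ m ≤ ℓ ⊔ r
  least ℓ r (ℓ≤m , _ , n<ℓ+r) = begin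
    suc n ∸ m    ≤⟨ ∸-mono n<ℓ+r ℓ≤m ⟩
    ℓ + r ∸ ℓ    ≡⟨ m+n∸m≡n ℓ r ⟩
    r            ≤⟨ m≤n⊔m ℓ r ⟩
    ℓ ⊔ r        ∎
    where open ≤-Reasoning

isMinMax-balanced : ∀ {m n} → ⌊ suc n /2⌋ ≤ m → 0 < n → IsMinMax m n ⌈ suc n /2⌉
isMinMax-balanced {n = suc k} half≤m _ =
  (⌊ suc (suc k) /2⌋ , ⌈ suc (suc k) /2⌉ , admissible , m≤n⇒m⊔n≡n (⌊n/2⌋≤⌈n/2⌉ (suc (suc k)))) ,
  λ ℓ r (_ , _ , n<ℓ+r) → n<ℓ+r⇒⌈1+n/2⌉≤ℓ⊔r ℓ r n<ℓ+r
  where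
  admissible : Admissible _ (suc k) ⌊ suc (suc k) /2⌋ ⌈ suc (suc k) /2⌉
  admissible = half≤m , s≤s⁻¹ (⌈n/2⌉<n k) , ≤-reflexive (≡-sym (⌊n/2⌋+⌈n/2⌉≡n (suc (suc k))))

side-↑ˡ : ∀ {m} n (i : Fin m) → side {m} {n} (i ↑ˡ n) ≡ true
side-↑ˡ n fzero    = refl
side-↑ˡ n (fsuc i) = side-↑ˡ n i

side-↑ʳ : ∀ m {n} (j : Fin n) → side {m} {n} (m ↑ʳ j) ≡ false
side-↑ʳ zero    j = refl
side-↑ʳ (suc m) j = side-↑ʳ m j

tabulate-side : ∀ m n → tabulate (side {m} {n}) ≡ ⊤ {m} ++ ⊥ {n}
tabulate-side zero    n = trans (tabulate-allFin _) (map-const (allFin n) false)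
tabulate-side (suc m) n = cong (true ∷_) (tabulate-side m n)

tabulate-not-side : ∀ m n → tabulate (not ∘ side {m} {n}) ≡ ⊥ {m} ++ ⊤ {n}
tabulate-not-side m n = begin
  tabulate (not ∘ side {m} {n})        ≡⟨ tabulate-∘ not (side {m} {n}) ⟩
  map not (tabulate (side {m} {n}))    ≡⟨ cong (map not) (tabulate-side m n) ⟩
  map not (⊤ {m} ++ ⊥ {n})             ≡⟨ map-++ not (⊤ {m}) (⊥ {n}) ⟩
  map not (⊤ {m}) ++ map not (⊥ {n})   ≡⟨ cong₂ _++_ (map-replicate not true m) (map-replicate not false n) ⟩
  ⊥ {m} ++ ⊤ {n}                       ∎
  where open ≡-Reasoning

module _ (m n : ℕ) where

  private
    G : Graph (m + n)
    G = completeBipartite m n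

  nbhd-left : ∀ v → side {m} {n} v ≡ true → nbhd G v ≡ ⊥ {m} ++ ⊤ {n}
  nbhd-left v left = trans (tabulate-cong (λ j → cong (_xor side {m} {n} j) left)) (tabulate-not-side m n)

  nbhd-right : ∀ v → side {m} {n} v ≡ false → nbhd G v ≡ ⊤ {m} ++ ⊥ {n}
  nbhd-right v right = trans (tabulate-cong (λ j → cong (_xor side {m} {n} j) right)) (tabulate-side m n)

  ∣p++q∩r++s∣ : ∀ (p r : Subset m) (q s : Subset n) → ∣ (p ++ q) ∩ (r ++ s) ∣ ≡ ∣ p ∩ r ∣ + ∣ q ∩ s ∣
  ∣p++q∩r++s∣ p r q s = trans (cong ∣_∣ (zipWith-++ _∧_ p q r s)) (∣p++q∣≡∣p∣+∣q∣ (p ∩ r) (q ∩ s))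

  degIn-left : ∀ L R v → side {m} {n} v ≡ true → degIn G (L ++ R) v ≡ ∣ R ∣
  degIn-left L R v left = begin
    ∣ (L ++ R) ∩ nbhd G v ∣       ≡⟨ cong (λ N → ∣ (L ++ R) ∩ N ∣) (nbhd-left v left) ⟩
    ∣ (L ++ R) ∩ (⊥ {m} ++ ⊤) ∣   ≡⟨ ∣p++q∩r++s∣ L ⊥ R ⊤ ⟩
    ∣ L ∩ ⊥ ∣ + ∣ R ∩ ⊤ ∣         ≡⟨ cong₂ _+_ (trans (cong ∣_∣ (∩-zeroʳ L)) (∣⊥∣≡0 m)) (cong ∣_∣ (∩-identityʳ R)) ⟩
    ∣ R ∣                         ∎
    where open ≡-Reasoning

  degIn-right : ∀ L R v → side {m} {n} v ≡ false → degIn G (L ++ R) v ≡ ∣ L ∣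
  degIn-right L R v right = begin
    ∣ (L ++ R) ∩ nbhd G v ∣       ≡⟨ cong (λ N → ∣ (L ++ R) ∩ N ∣) (nbhd-right v right) ⟩
    ∣ (L ++ R) ∩ (⊤ {m} ++ ⊥) ∣   ≡⟨ ∣p++q∩r++s∣ L ⊤ R ⊥ ⟩
    ∣ L ∩ ⊤ ∣ + ∣ R ∩ ⊥ ∣         ≡⟨ cong₂ _+_ (cong ∣_∣ (∩-identityʳ L)) (trans (cong ∣_∣ (∩-zeroʳ R)) (∣⊥∣≡0 n)) ⟩
    ∣ L ∣ + 0                     ≡⟨ +-identityʳ ∣ L ∣ ⟩
    ∣ L ∣                         ∎
    where open ≡-Reasoning

  maxDegIn-++ : ∀ L R → 0 < ∣ L ∣ → 0 < ∣ R ∣ → maxDegIn G (L ++ R) ≡ ∣ L ∣ ⊔ ∣ R ∣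
  maxDegIn-++ L R 0<∣L∣ 0<∣R∣ = begin
    foldr′ _⊔_ 0 (map deg (allFin (m + n)))
      ≡⟨ cong (foldr′ _⊔_ 0) (≡-sym (tabulate-allFin deg)) ⟩
    foldr′ _⊔_ 0 (tabulate deg)
      ≡⟨ cong (foldr′ _⊔_ 0) (tabulate-++ m deg) ⟩
    foldr′ _⊔_ 0 (tabulate (λ i → deg (i ↑ˡ n)) ++ tabulate (λ j → deg (m ↑ʳ j)))
      ≡⟨ cong (foldr′ _⊔_ 0) (cong₂ _++_ (tabulate-members L ∣ R ∣ (_↑ˡ n) left) (tabulate-members R ∣ L ∣ (m ↑ʳ_) right)) ⟩
    foldr′ _⊔_ 0 (map (ifMember ∣ R ∣) L ++ map (ifMember ∣ L ∣) R)
      ≡⟨ ⊔-foldr-++ (map (ifMember ∣ R ∣) L) (map (ifMember ∣ L ∣) R) ⟩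
    foldr′ _⊔_ 0 (map (ifMember ∣ R ∣) L) ⊔ foldr′ _⊔_ 0 (map (ifMember ∣ L ∣) R)
      ≡⟨ cong₂ _⊔_ (⊔-foldr-ifMember ∣ R ∣ L 0<∣L∣) (⊔-foldr-ifMember ∣ L ∣ R 0<∣R∣) ⟩
    ∣ R ∣ ⊔ ∣ L ∣
      ≡⟨ ⊔-comm ∣ R ∣ ∣ L ∣ ⟩
    ∣ L ∣ ⊔ ∣ R ∣
      ∎
    where
    open ≡-Reasoning
    deg : Fin (m + n) → ℕ
    deg v = ifMember (degIn G (L ++ R) v) (lookup (L ++ R) v)

    tabulate-members : ∀ {k} (p : Subset k) x (f : Fin k → Fin (m + n)) →
      (∀ i → deg (f i) ≡ ifMember x (lookup p i)) → tabulate (deg ∘ f) ≡ map (ifMember x) p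
    tabulate-members p x f deg∘f≗ = begin
      tabulate (deg ∘ f)                       ≡⟨ tabulate-cong deg∘f≗ ⟩
      tabulate (ifMember x ∘ lookup p)         ≡⟨ tabulate-∘ (ifMember x) (lookup p) ⟩
      map (ifMember x) (tabulate (lookup p))   ≡⟨ cong (map (ifMember x)) (tabulate∘lookup p) ⟩
      map (ifMember x) p                       ∎

    left : ∀ i → deg (i ↑ˡ n) ≡ ifMember ∣ R ∣ (lookup L i)
    left i = cong₂ ifMember (degIn-left L R (i ↑ˡ n) (side-↑ˡ n i)) (lookup-++ˡ L R i)

    right : ∀ j → deg (m ↑ʳ j) ≡ ifMember ∣ L ∣ (lookup R j)
    right j = cong₂ ifMember (degIn-right L R (m ↑ʳ j) (side-↑ʳ m j)) (lookup-++ʳ L R j)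

  rightSide : Subset (m + n)
  rightSide = tabulate (not ∘ side {m} {n})

  rightSide-independent : Independent G rightSide
  rightSide-independent i j i∈ j∈ = cong₂ _xor_ (onRight i i∈) (onRight j j∈)
    where
    onRight : ∀ v → v ∈ rightSide → side {m} {n} v ≡ false
    onRight v v∈ = not-injective (trans (≡-sym (lookup∘tabulate (not ∘ side {m} {n}) v)) ([]=⇒lookup v∈))

  ∣rightSide∣≡n : ∣ rightSide ∣ ≡ n
  ∣rightSide∣≡n = begin
    ∣ rightSide ∣          ≡⟨ cong ∣_∣ (tabulate-not-side m n) ⟩
    ∣ ⊥ {m} ++ ⊤ {n} ∣     ≡⟨ ∣p++q∣≡∣p∣+∣q∣ (⊥ {m}) (⊤ {n}) ⟩
    ∣ ⊥ {m} ∣ + ∣ ⊤ {n} ∣  ≡⟨ cong₂ _+_ (∣⊥∣≡0 m) (∣⊤∣≡n n) ⟩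
    n                      ∎
    where open ≡-Reasoning

  independent-++ : ∀ L R → Independent G (L ++ R) → Empty L ⊎ Empty R
  independent-++ L R indep with nonempty? L | nonempty? R
  ... | no L-empty | _          = inj₁ L-empty
  ... | yes _      | no R-empty = inj₂ R-empty
  ... | yes (i , i∈L) | yes (j , j∈R) =
    contradiction (trans (≡-sym adjacent) (indep _ _ (∈-++⁺ˡ R i∈L) (∈-++⁺ʳ L j∈R))) λ ()
    where
    adjacent : adj G (i ↑ˡ n) (m ↑ʳ j) ≡ true
    adjacent = cong₂ _xor_ (side-↑ˡ n i) (side-↑ʳ m j)

  ∣independent∣≤n : m ≤ n → ∀ S → Independent G S → ∣ S ∣ ≤ n
  ∣independent∣≤n m≤n S indep with splitAt m S
  ... | L , R , refl with independent-++ L R indep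
  ...   | inj₁ L-empty = begin
    ∣ L ++ R ∣      ≡⟨ ∣p++q∣≡∣p∣+∣q∣ L R ⟩
    ∣ L ∣ + ∣ R ∣   ≡⟨ cong (_+ ∣ R ∣) (∣Empty∣≡0 L-empty) ⟩
    ∣ R ∣           ≤⟨ ∣p∣≤n R ⟩
    n               ∎
    where open ≤-Reasoning
  ...   | inj₂ R-empty = begin
    ∣ L ++ R ∣      ≡⟨ ∣p++q∣≡∣p∣+∣q∣ L R ⟩
    ∣ L ∣ + ∣ R ∣   ≡⟨ cong (∣ L ∣ +_) (∣Empty∣≡0 R-empty) ⟩
    ∣ L ∣ + 0       ≡⟨ +-identityʳ ∣ L ∣ ⟩
    ∣ L ∣           ≤⟨ ∣p∣≤n L ⟩
    m               ≤⟨ m≤n ⟩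
    n               ∎
    where open ≤-Reasoning

  independenceNumber : m ≤ n → IsIndependenceNumber G n
  independenceNumber m≤n = (rightSide , rightSide-independent , ∣rightSide∣≡n) , ∣independent∣≤n m≤n

  maxDegIn-beyond-α : m ≤ n → ∀ S → n < ∣ S ∣ → ∃₂ λ ℓ r → Admissible m n ℓ r × maxDegIn G S ≡ ℓ ⊔ r
  maxDegIn-beyond-α m≤n S n<∣S∣ with splitAt m S
  ... | L , R , refl = ∣ L ∣ , ∣ R ∣ , admissible , maxDegIn-++ L R 0<∣L∣ 0<∣R∣
    where
    admissible : Admissible m n ∣ L ∣ ∣ R ∣
    admissible = ∣p∣≤n L , ∣p∣≤n R , subst (n <_) (∣p++q∣≡∣p∣+∣q∣ L R) n<∣S∣
    0<∣L∣ : 0 < ∣ L ∣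
    0<∣L∣ = proj₁ (admissible-positive m≤n admissible)
    0<∣R∣ : 0 < ∣ R ∣
    0<∣R∣ = proj₂ (admissible-positive m≤n admissible)

  admissible-realised : ∀ {ℓ r} → m ≤ n → Admissible m n ℓ r → ∃[ S ] n < ∣ S ∣ × maxDegIn G S ≡ ℓ ⊔ r
  admissible-realised m≤n admissible@(ℓ≤m , r≤n , n<ℓ+r) with subsetOfSize ℓ≤m | subsetOfSize r≤n
  ... | L , refl | R , refl =
    L ++ R , subst (n <_) (≡-sym (∣p++q∣≡∣p∣+∣q∣ L R)) n<ℓ+r , maxDegIn-++ L R 0<∣L∣ 0<∣R∣
    where
    0<∣L∣ : 0 < ∣ L ∣
    0<∣L∣ = proj₁ (admissible-positive m≤n admissible)
    0<∣R∣ : 0 < ∣ R ∣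
    0<∣R∣ = proj₂ (admissible-positive m≤n admissible)

  isMinMax⇒isSensitivity : ∀ {s} → m ≤ n → IsMinMax m n s → IsSensitivity G s
  isMinMax⇒isSensitivity {s} m≤n ((ℓ , r , admissible , ℓ⊔r≡s) , least) with admissible-realised m≤n admissible
  ... | S , n<∣S∣ , maxDeg≡ℓ⊔r =
    n , independenceNumber m≤n , (S , n<∣S∣ , trans maxDeg≡ℓ⊔r ℓ⊔r≡s) , atLeast
    where
    atLeast : ∀ T → n < ∣ T ∣ → s ≤ maxDegIn G T
    atLeast T n<∣T∣ with maxDegIn-beyond-α m≤n T n<∣T∣
    ... | ℓ′ , r′ , admissible′ , maxDeg≡ = subst (s ≤_) (≡-sym maxDeg≡) (least ℓ′ r′ admissible′)

  ⌈1+n/2⌉≤sensitivity : ∀ {s} → m ≤ n → IsSensitivity G s → ⌈ suc n /2⌉ ≤ s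
  ⌈1+n/2⌉≤sensitivity m≤n (a , (_ , maximal) , (S , a<∣S∣ , maxDeg≡s) , _)
    with maxDegIn-beyond-α m≤n S (≤-<-trans n≤a a<∣S∣)
    where
    n≤a : n ≤ a
    n≤a = subst (_≤ a) ∣rightSide∣≡n (maximal rightSide rightSide-independent)
  ... | ℓ , r , (_ , _ , n<ℓ+r) , maxDeg≡ =
    subst (⌈ suc n /2⌉ ≤_) (trans (≡-sym maxDeg≡) maxDeg≡s) (n<ℓ+r⇒⌈1+n/2⌉≤ℓ⊔r ℓ r n<ℓ+r)

  maxDeg-completeBipartite : 0 < m → m ≤ n → maxDeg G ≡ n
  maxDeg-completeBipartite 0<m m≤n = begin
    maxDegIn G ⊤                  ≡⟨ cong (maxDegIn G) (⊤-++ m n) ⟩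
    maxDegIn G (⊤ {m} ++ ⊤ {n})   ≡⟨ maxDegIn-++ ⊤ ⊤ (positive m 0<m) (positive n (≤-trans 0<m m≤n)) ⟩
    ∣ ⊤ {m} ∣ ⊔ ∣ ⊤ {n} ∣         ≡⟨ cong₂ _⊔_ (∣⊤∣≡n m) (∣⊤∣≡n n) ⟩
    m ⊔ n                         ≡⟨ m≤n⇒m⊔n≡n m≤n ⟩
    n                             ∎
    where
    open ≡-Reasoning
    positive : ∀ k → 0 < k → 0 < ∣ ⊤ {k} ∣
    positive k = subst (0 <_) (≡-sym (∣⊤∣≡n k))

completeBipartite-sensitive : {I : Set} (m n : I → ℕ) → (∀ i → 0 < m i) → (∀ i → m i ≤ n i) →
  Sensitive n (λ i → m i + n i) (λ i → completeBipartite (m i) (n i))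
completeBipartite-sensitive m n 0<m m≤n =
  (λ B → B , λ i B≤n → subst (B ≤_) (≡-sym (maxDeg-completeBipartite (m i) (n i) (0<m i) (m≤n i))) B≤n) ,
  (λ B → B + B , λ i B+B≤n s σ →
    ≤-trans (B+B≤n⇒B≤⌈1+n/2⌉ B+B≤n) (⌈1+n/2⌉≤sensitivity (m i) (n i) (m≤n i) σ))

corollary3p2 :
    ((m n : ℕ) → 1 ≤ m → m ≤ n →
      (m ≤ ⌊ suc n /2⌋ → IsSensitivity (completeBipartite m n) (suc n ∸ m)) ×
      (⌊ suc n /2⌋ < m → IsSensitivity (completeBipartite m n) ⌈ suc n /2⌉)) ×
    ((m : ℕ) → 1 ≤ m →
      Sensitive {Σ ℕ (λ n → m ≤ n)} proj₁ (λ p → m + proj₁ p)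
        (λ p → completeBipartite m (proj₁ p))) ×
    Sensitive {Σ ℕ (λ m → Σ ℕ (λ n → (⌊ suc n /2⌋ < m) × (m ≤ n)))}
      (λ p → proj₁ (proj₂ p)) (λ p → proj₁ p + proj₁ (proj₂ p))
      (λ p → completeBipartite (proj₁ p) (proj₁ (proj₂ p))) ×
    ((n : ℕ) → 1 ≤ n → IsSensitivity (completeBipartite n n) ⌈ suc n /2⌉) ×
    Sensitive {Σ ℕ (λ n → 1 ≤ n)} proj₁ (λ p → proj₁ p + proj₁ p)
      (λ p → completeBipartite (proj₁ p) (proj₁ p))
corollary3p2 =
  (λ m n 0<m m≤n →
    (λ m≤half → isMinMax⇒isSensitivity m n m≤n (isMinMax-unbalanced 0<m m≤half)) ,
    (λ half<m → isMinMax⇒isSensitivity m n m≤n (isMinMax-balanced (<⇒≤ half<m) (≤-trans 0<m m≤n)))) ,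
  (λ m 0<m → completeBipartite-sensitive (λ _ → m) proj₁ (λ _ → 0<m) proj₂) ,
  completeBipartite-sensitive proj₁ (proj₁ ∘ proj₂)
    (λ (_ , _ , half<m , _) → ≤-trans z<s half<m) (proj₂ ∘ proj₂ ∘ proj₂) ,
  (λ n 0<n → isMinMax⇒isSensitivity n n ≤-refl (isMinMax-balanced (s≤s⁻¹ (⌊n/2⌋<n n)) 0<n)) ,
  completeBipartite-sensitive proj₁ proj₁ proj₂ (λ _ → ≤-refl)
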